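{- For every instance $I=\langle G,l,f,\omega\rangle$ and all sets $R_1,R_2\subseteq V$, with $I'$ the derived instance (with respect to $R_1$) defined in the context, $C_{RFTFL}(I,R_1\cup R_2)\le C_{UFL}(I,R_1)+C_{conc\_bu}(I',R_1,R_2)$.
   Context: $G=(V,E)$ is a graph with $V=\{1,\dots,n\}$ and positive edge lengths $l$; $d$ is the shortest-path distance; $d(v,R)=\min_{r\in R}d(v,r)$ (with $d(v,\emptyset)=+\infty$). Each node has opening cost $f(v)\ge0$ and demand $\omega(v)\ge0$. For $R\subseteq V$: $C_{facil}(I,R)=\sum_{r\in R}f(r)$, $C_{ship}(I,R)=\sum_{u\in V}\omega(u)d(u,R)$, $C_{UFL}(I,R)=C_{facil}(I,R)+C_{ship}(I,R)$, and $C_{RFTFL}(I,R)=C_{facil}(I,R)+\max_{r\in R}\sum_{v\in V}\omega(v)\,d(v,R\setminus\{r\})$. For $R\subseteq V$ and $r\in R$, $\varphi(I,r,R)$ is the set of clients assigned to $r$, where each $u\in V$ is assigned to one facility $r\in R$ with $d(u,r)=d(u,R)$ (ties broken arbitrarily). The derived instance is $I'=\langle G,l,f',\omega'\rangle$ with $f'(r)=0$ for $r\in R_1$, $f'(v)=f(v)$ otherwise, and $\omega'(r)=\sum_{v\in\varphi(I,r,R_1)}\omega(v)$ for $r\in R_1$, $\omega'(v)=0$ for $v\notin R_1$. Then $C_{conc\_bu}(I',R_1,R_2)=\sum_{v\in R_2}f'(v)+\max_{r\in R_1}\omega'(r)\,d(r,(R_1\cup R_2)\setminus\{r\})$.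
   Formalization: The edge lengths $l$, the opening costs $f$ and the demands $\omega$ take values in the rationals. -}

module Defs where

open import Data.Nat using (ℕ)
open import Data.Bool using (Bool; true; false; if_then_else_)
open import Data.Fin using (Fin; _≟_)
open import Data.Fin.Subset using (Subset; _∈_; _-_; _∪_)
open import Data.Vec using (lookup)
open import Data.List using (List; []; _∷_; foldr; map)
open import Data.List using () renaming (allFin to allFinL)
open import Data.Rational using (ℚ; 0ℚ; _+_; _*_; _≤_; _<_; _⊔_; _⊓_)
open import Data.Product using (Σ; _×_; _,_; ∃)
open import Data.Sum using (_⊎_)
open import Data.Empty using (⊥)
open import Relation.Nullary using (¬_; does)
open import Relation.Binary.PropositionalEquality using (_≡_)

-- Extended non-negative costs: ℚ ∪ {+∞}

data ℚ∞ : Set where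
  fin : ℚ → ℚ∞
  ∞   : ℚ∞

infixl 6 _+∞_
_+∞_ : ℚ∞ → ℚ∞ → ℚ∞
fin x +∞ fin y = fin (x + y)
_     +∞ _     = ∞

min∞ : ℚ∞ → ℚ∞ → ℚ∞
min∞ (fin x) (fin y) = fin (x ⊓ y)
min∞ (fin x) ∞       = fin x
min∞ ∞       y       = y

max∞ : ℚ∞ → ℚ∞ → ℚ∞
max∞ (fin x) (fin y) = fin (x ⊔ y)
max∞ _       _       = ∞

-- scalar multiplication of a (non-negative) rational by an extended value,
-- with the convention 0 · ∞ = 0
_·∞_ : ℚ → ℚ∞ → ℚ∞
w ·∞ fin x = fin (w * x)
w ·∞ ∞ with does (Data.Rational._≟_ w 0ℚ)
... | true  = fin 0ℚ
... | false = ∞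

data _≤∞_ : ℚ∞ → ℚ∞ → Set where
  fin≤fin : ∀ {x y} → x ≤ y → fin x ≤∞ fin y
  _≤∞∞    : ∀ x → x ≤∞ ∞

-- Graphs on V = {1..n} (here Fin n), undirected, positive edge lengths

record Graph (n : ℕ) : Set₁ where
  field
    E     : Fin n → Fin n → Set
    E-sym : ∀ {u v} → E u v → E v u
    l     : Fin n → Fin n → ℚ
    l-sym : ∀ u v → l u v ≡ l v u
    l-pos : ∀ {u v} → E u v → 0ℚ < l u v

module _ {n : ℕ} (G : Graph n) where
  open Graph G

  data Walk : Fin n → Fin n → Set where
    []  : ∀ {u} → Walk u u
    _∷_ : ∀ {u w v} → E u w → Walk w v → Walk u v

  walkLength : ∀ {u v} → Walk u v → ℚ
  walkLength []               = 0ℚ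
  walkLength (_∷_ {u} {w} _ p) = l u w + walkLength p

  IsShortestPathDist : (Fin n → Fin n → ℚ∞) → Set
  IsShortestPathDist d = ∀ u v →
      (d u v ≡ ∞ × ¬ Walk u v)
    ⊎ (Σ ℚ λ x → d u v ≡ fin x
         × (Σ (Walk u v) λ p → walkLength p ≡ x)
         × (∀ (p : Walk u v) → x ≤ walkLength p))

allFin : (n : ℕ) → List (Fin n)
allFin = allFinL

module _ {n : ℕ} where

  sumV : (Fin n → ℚ) → ℚ
  sumV g = foldr (λ v acc → g v + acc) 0ℚ (allFin n)

  sumV∞ : (Fin n → ℚ∞) → ℚ∞
  sumV∞ g = foldr (λ v acc → g v +∞ acc) (fin 0ℚ) (allFin n)

  sumSet : Subset n → (Fin n → ℚ) → ℚ
  sumSet R g = sumV (λ v → if lookup R v then g v else 0ℚ)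

  -- min_{r ∈ R} g r   (= ∞ for R = ∅)
  minSet : Subset n → (Fin n → ℚ∞) → ℚ∞
  minSet R g = foldr (λ v acc → if lookup R v then min∞ (g v) acc else acc) ∞ (allFin n)

  -- max_{r ∈ R} g r   (= 0 for R = ∅; all values involved are ≥ 0)
  maxSet : Subset n → (Fin n → ℚ∞) → ℚ∞
  maxSet R g = foldr (λ v acc → if lookup R v then max∞ (g v) acc else acc) (fin 0ℚ) (allFin n)

module Costs {n : ℕ} (d : Fin n → Fin n → ℚ∞) (f ω : Fin n → ℚ) where

  dist : Fin n → Subset n → ℚ∞
  dist v R = minSet R (λ r → d v r)

  Cfacil : Subset n → ℚ
  Cfacil R = sumSet R f

  Cship : Subset n → ℚ∞
  Cship R = sumV∞ (λ u → ω u ·∞ dist u R)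

  CUFL : Subset n → ℚ∞
  CUFL R = fin (Cfacil R) +∞ Cship R

  CRFTFL : Subset n → ℚ∞
  CRFTFL R = fin (Cfacil R) +∞ maxSet R (λ r → sumV∞ (λ v → ω v ·∞ dist v (R - r)))

  -- a : V → V is an assignment of clients to facilities of R
  -- (φ(I,r,R) = { u | a u = r }): each client goes to a nearest facility of R.
  IsAssignment : Subset n → (Fin n → Fin n) → Set
  IsAssignment R a = ∀ u → Σ (Fin n) (λ r → r ∈ R) → a u ∈ R × d u (a u) ≡ dist u R

module Derived {n : ℕ} (f ω : Fin n → ℚ) (R₁ : Subset n) (a : Fin n → Fin n) where

  f' : Fin n → ℚ
  f' v = if lookup R₁ v then 0ℚ else f v

  ω' : Fin n → ℚ
  ω' v = if lookup R₁ v
           then sumV (λ u → if does (a u ≟ v) then ω u else 0ℚ)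
           else 0ℚ

Cconcbu : ∀ {n} (d : Fin n → Fin n → ℚ∞) (f' ω' : Fin n → ℚ) (R₁ R₂ : Subset n) → ℚ∞
Cconcbu d f' ω' R₁ R₂ =
  fin (sumSet R₂ f') +∞
  maxSet R₁ (λ r → ω' r ·∞ Costs.dist d f' ω' r ((R₁ ∪ R₂) - r))

module Submission where

-- Let R = R₁ ∪ R₂, let r ∈ R be the facility that fails, and let v be a client
-- served in I by its nearest facility a v ∈ R₁.  If a v ≠ r then a v survives
-- in R − r and v keeps paying d(v,R₁).  If a v = r (so r ∈ R₁), v walks to r
-- and on to the nearest surviving facility, paying at most d(v,R₁) + d(r,R−r)
-- by the triangle inequality.  Summed over the clients, the rerouted demand is
-- exactly ω'(r), so the cost of losing r is at most
-- C_ship(I,R₁) + ω'(r)·d(r,R−r), and the second term is bounded by the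
-- bottleneck term of C_conc_bu.  Maximising over r and adding the facility
-- costs, where f' vanishes on R₁, gives the lemma.

open import Defs
open import Data.Nat using (ℕ)
open import Data.Fin using (Fin)
open import Data.Fin.Subset using (Subset; _∪_)
open import Data.Rational using (ℚ; 0ℚ; _≤_)

open import Data.Bool using (Bool; true; false; if_then_else_; _∨_)
open import Data.Fin using (_≟_)
open import Data.Fin.Subset using (_-_) renaming (_∈_ to _∈ˢ_)
open import Data.Fin.Subset.Properties using (x∈p∪q⁺; x∈p∧x≢y⇒x∈p-y)
open import Data.Vec using (lookup)
open import Data.Vec.Properties using ([]=⇒lookup; lookup⇒[]=; lookup-zipWith)
open import Data.List using (List; []; _∷_; foldr)
open import Data.List.Membership.Propositional using () renaming (_∈_ to _∈ˡ_)
open import Data.List.Membership.Propositional.Properties using (∈-allFin)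
open import Data.List.Relation.Unary.Any using (here; there)
open import Data.Product using (Σ; _×_; _,_)
open import Data.Sum using (_⊎_; inj₁; inj₂)
open import Data.Empty using (⊥-elim)
open import Relation.Nullary using (Dec; does; yes; no)
open import Relation.Nullary.Decidable using (dec-true)
open import Relation.Binary.PropositionalEquality using (_≡_; _≢_; refl; sym; trans; cong; cong₂; subst; isEquivalence)
open import Relation.Binary.Bundles using (Preorder)
import Relation.Binary.Reasoning.Preorder as PreorderReasoning
import Data.Rational as ℚ
open import Data.Rational.Properties hiding (_≟_)
open import Algebra.Bundles using (CommutativeMonoid)
open import Algebra.Properties.CommutativeSemigroup
  (CommutativeMonoid.commutativeSemigroup +-0-commutativeMonoid) using (interchange)

scale-mono : ∀ {w x y} → 0ℚ ≤ w → x ≤ y → w ℚ.* x ≤ w ℚ.* y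
scale-mono {w} 0≤w = *-monoˡ-≤-nonNeg w {{ℚ.nonNegative 0≤w}}

+-nonNeg : ∀ {x y} → 0ℚ ≤ x → 0ℚ ≤ y → 0ℚ ≤ x ℚ.+ y
+-nonNeg 0≤x 0≤y = ≤-trans (≤-reflexive (sym (+-identityʳ 0ℚ))) (+-mono-≤ 0≤x 0≤y)

*-nonNeg : ∀ {w x} → 0ℚ ≤ w → 0ℚ ≤ x → 0ℚ ≤ w ℚ.* x
*-nonNeg {w} 0≤w 0≤x = ≤-trans (≤-reflexive (sym (*-zeroʳ w))) (scale-mono 0≤w 0≤x)

nonNeg-sum-zero : ∀ {x y} → 0ℚ ≤ x → 0ℚ ≤ y → x ℚ.+ y ≡ 0ℚ → x ≡ 0ℚ × y ≡ 0ℚ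
nonNeg-sum-zero {x} {y} 0≤x 0≤y x+y≡0 =
  ≤-antisym (≤-trans (≤-reflexive (sym (+-identityʳ x))) (≤-trans (+-monoʳ-≤ x 0≤y) (≤-reflexive x+y≡0))) 0≤x ,
  ≤-antisym (≤-trans (≤-reflexive (sym (+-identityˡ y))) (≤-trans (+-monoˡ-≤ y 0≤x) (≤-reflexive x+y≡0))) 0≤y

select : Bool → ℚ → ℚ
select b x = if b then x else 0ℚ

select-nonNeg : ∀ b {x} → 0ℚ ≤ x → 0ℚ ≤ select b x
select-nonNeg true  0≤x = 0≤x
select-nonNeg false _   = ≤-refl

NonNeg∞ : ℚ∞ → Set
NonNeg∞ x = fin 0ℚ ≤∞ x

≤∞-refl : ∀ {x} → x ≤∞ x
≤∞-refl {fin x} = fin≤fin ≤-refl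
≤∞-refl {∞}     = ∞ ≤∞∞

≤∞-reflexive : ∀ {x y} → x ≡ y → x ≤∞ y
≤∞-reflexive refl = ≤∞-refl

≤∞-trans : ∀ {x y z} → x ≤∞ y → y ≤∞ z → x ≤∞ z
≤∞-trans (fin≤fin p) (fin≤fin q) = fin≤fin (≤-trans p q)
≤∞-trans {x} _       (_ ≤∞∞)     = x ≤∞∞

≤∞-preorder : Preorder _ _ _
≤∞-preorder = record
  { Carrier    = ℚ∞
  ; _≈_        = _≡_
  ; _≲_        = _≤∞_
  ; isPreorder = record
    { isEquivalence = isEquivalence
    ; reflexive     = ≤∞-reflexive
    ; trans         = ≤∞-trans
    }
  }

module ≤∞-Reasoning = PreorderReasoning ≤∞-preorder

+∞-mono : ∀ {x x′ y y′} → x ≤∞ x′ → y ≤∞ y′ → (x +∞ y) ≤∞ (x′ +∞ y′)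
+∞-mono (fin≤fin p) (fin≤fin q) = fin≤fin (+-mono-≤ p q)
+∞-mono (fin≤fin _) (_ ≤∞∞)     = _ ≤∞∞
+∞-mono (_ ≤∞∞)     _           = _ ≤∞∞

+∞-nonNeg : ∀ {x y} → NonNeg∞ x → NonNeg∞ y → NonNeg∞ (x +∞ y)
+∞-nonNeg (fin≤fin p) (fin≤fin q) = fin≤fin (+-nonNeg p q)
+∞-nonNeg (fin≤fin _) (_ ≤∞∞)     = _ ≤∞∞
+∞-nonNeg (_ ≤∞∞)     _           = _ ≤∞∞

≤∞-+nonNeg : ∀ x {y} → NonNeg∞ y → x ≤∞ (x +∞ y)
≤∞-+nonNeg (fin x) (fin≤fin 0≤y) =
  fin≤fin (≤-trans (≤-reflexive (sym (+-identityʳ x))) (+-monoʳ-≤ x 0≤y))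
≤∞-+nonNeg (fin x) (_ ≤∞∞) = _ ≤∞∞
≤∞-+nonNeg ∞       _       = _ ≤∞∞

∞-absorbˡ : ∀ {x y z} → x ≡ ∞ → y ≤∞ (x +∞ z)
∞-absorbˡ refl = _ ≤∞∞

∞-absorbʳ : ∀ x {y z} → y ≡ ∞ → z ≤∞ (x +∞ y)
∞-absorbʳ (fin x) refl = _ ≤∞∞
∞-absorbʳ ∞       refl = _ ≤∞∞

+∞-interchange : ∀ w x y z → (w +∞ x) +∞ (y +∞ z) ≡ (w +∞ y) +∞ (x +∞ z)
+∞-interchange (fin w) (fin x) (fin y) (fin z) = cong fin (interchange w x y z)
+∞-interchange (fin w) (fin x) (fin y) ∞       = refl
+∞-interchange (fin w) (fin x) ∞       _       = refl
+∞-interchange (fin w) ∞       (fin y) _       = refl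
+∞-interchange (fin w) ∞       ∞       _       = refl
+∞-interchange ∞       _       _       _       = refl

-- Extended costs ℚ∞: scaling by a demand, with 0 · ∞ = 0.  A case split on
-- `w ℚ.≟ 0ℚ` mirrors the definition of ·∞, so in each branch w ·∞ ∞ computes
-- to fin 0ℚ or to ∞ respectively.

zero-·∞ : ∀ {w} x → w ≡ 0ℚ → w ·∞ x ≡ fin 0ℚ
zero-·∞ (fin x) refl = cong fin (*-zeroˡ x)
zero-·∞ ∞       refl = refl

nonZero-·∞∞ : ∀ {w} → w ≢ 0ℚ → w ·∞ ∞ ≡ ∞
nonZero-·∞∞ {w} w≢0 with w ℚ.≟ 0ℚ
... | yes w≡0 = ⊥-elim (w≢0 w≡0)
... | no _    = refl

·∞-nonNeg : ∀ {w x} → 0ℚ ≤ w → NonNeg∞ x → NonNeg∞ (w ·∞ x)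
·∞-nonNeg     0≤w (fin≤fin 0≤x) = fin≤fin (*-nonNeg 0≤w 0≤x)
·∞-nonNeg {w} 0≤w (_ ≤∞∞) with w ℚ.≟ 0ℚ
... | yes _ = ≤∞-refl
... | no  _ = _ ≤∞∞

·∞-monoʳ : ∀ {w x y} → 0ℚ ≤ w → x ≤∞ y → (w ·∞ x) ≤∞ (w ·∞ y)
·∞-monoʳ         0≤w (fin≤fin p) = fin≤fin (scale-mono 0≤w p)
·∞-monoʳ {w} {x} 0≤w (_ ≤∞∞) with w ℚ.≟ 0ℚ
... | yes w≡0 = ≤∞-reflexive (zero-·∞ x w≡0)
... | no  _   = _ ≤∞∞

·∞-subdistrib : ∀ w x y → (w ·∞ (x +∞ y)) ≤∞ (w ·∞ x +∞ w ·∞ y)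
·∞-subdistrib w x y with w ℚ.≟ 0ℚ
... | yes w≡0 = begin
  w ·∞ (x +∞ y)     ≡⟨ zero-·∞ (x +∞ y) w≡0 ⟩
  fin 0ℚ            ≲⟨ fin≤fin (≤-reflexive (sym (+-identityʳ 0ℚ))) ⟩
  fin 0ℚ +∞ fin 0ℚ  ≡⟨ sym (cong₂ _+∞_ (zero-·∞ x w≡0) (zero-·∞ y w≡0)) ⟩
  w ·∞ x +∞ w ·∞ y  ∎
  where open ≤∞-Reasoning
... | no w≢0 = nonZero-case x y
  where
  nonZero-case : ∀ x y → (w ·∞ (x +∞ y)) ≤∞ (w ·∞ x +∞ w ·∞ y)
  nonZero-case (fin x) (fin y) = fin≤fin (≤-reflexive (*-distribˡ-+ w x y))
  nonZero-case (fin x) ∞       = ∞-absorbʳ (fin (w ℚ.* x)) (nonZero-·∞∞ w≢0)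
  nonZero-case ∞       y       = ∞-absorbˡ (nonZero-·∞∞ w≢0)

·∞-superdistrib : ∀ {c s} D → 0ℚ ≤ c → 0ℚ ≤ s → (c ·∞ D +∞ s ·∞ D) ≤∞ ((c ℚ.+ s) ·∞ D)
·∞-superdistrib {c} {s} (fin x) _ _ = fin≤fin (≤-reflexive (sym (*-distribʳ-+ x c s)))
·∞-superdistrib {c} {s} ∞ 0≤c 0≤s with (c ℚ.+ s) ℚ.≟ 0ℚ
... | no _ = _ ≤∞∞
... | yes c+s≡0 with nonNeg-sum-zero 0≤c 0≤s c+s≡0
...   | c≡0 , s≡0 = begin
  c ·∞ ∞ +∞ s ·∞ ∞  ≡⟨ cong₂ _+∞_ (zero-·∞ ∞ c≡0) (zero-·∞ ∞ s≡0) ⟩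
  fin (0ℚ ℚ.+ 0ℚ)   ≡⟨ cong fin (+-identityʳ 0ℚ) ⟩
  fin 0ℚ            ∎
  where open ≤∞-Reasoning

min∞-sel : ∀ x y → min∞ x y ≡ x ⊎ min∞ x y ≡ y
min∞-sel (fin x) (fin y) with ⊓-sel x y
... | inj₁ x⊓y≡x = inj₁ (cong fin x⊓y≡x)
... | inj₂ x⊓y≡y = inj₂ (cong fin x⊓y≡y)
min∞-sel (fin x) ∞ = inj₁ refl
min∞-sel ∞       y = inj₂ refl

min∞-≤ˡ : ∀ x y → min∞ x y ≤∞ x
min∞-≤ˡ (fin x) (fin y) = fin≤fin (p⊓q≤p x y)
min∞-≤ˡ (fin x) ∞       = ≤∞-refl
min∞-≤ˡ ∞       y       = _ ≤∞∞

min∞-≤ʳ : ∀ x y → min∞ x y ≤∞ y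
min∞-≤ʳ (fin x) (fin y) = fin≤fin (p⊓q≤q x y)
min∞-≤ʳ (fin x) ∞       = _ ≤∞∞
min∞-≤ʳ ∞       y       = ≤∞-refl

max∞-≥ˡ : ∀ x y → x ≤∞ max∞ x y
max∞-≥ˡ (fin x) (fin y) = fin≤fin (p≤p⊔q x y)
max∞-≥ˡ (fin x) ∞       = _ ≤∞∞
max∞-≥ˡ ∞       y       = _ ≤∞∞

max∞-≥ʳ : ∀ x y → y ≤∞ max∞ x y
max∞-≥ʳ (fin x) (fin y) = fin≤fin (p≤q⊔p x y)
max∞-≥ʳ (fin x) ∞       = _ ≤∞∞
max∞-≥ʳ ∞       y       = _ ≤∞∞

max∞-lub : ∀ {x y z} → x ≤∞ z → y ≤∞ z → max∞ x y ≤∞ z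
max∞-lub (fin≤fin p) (fin≤fin q) = fin≤fin (⊔-lub p q)
max∞-lub _           (_ ≤∞∞)     = _ ≤∞∞

module Folds {n : ℕ} where

  -- The folds used in Defs, over an arbitrary list of vertices: on the list
  -- `allFin n` they are minSet, maxSet, sumV∞ and sumV respectively.
  minL : Subset n → (Fin n → ℚ∞) → List (Fin n) → ℚ∞
  minL R g xs = foldr (λ v acc → if lookup R v then min∞ (g v) acc else acc) ∞ xs

  maxL : Subset n → (Fin n → ℚ∞) → List (Fin n) → ℚ∞
  maxL R g xs = foldr (λ v acc → if lookup R v then max∞ (g v) acc else acc) (fin 0ℚ) xs

  sumL∞ : (Fin n → ℚ∞) → List (Fin n) → ℚ∞
  sumL∞ g xs = foldr (λ v acc → g v +∞ acc) (fin 0ℚ) xs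

  sumL : (Fin n → ℚ) → List (Fin n) → ℚ
  sumL g xs = foldr (λ v acc → g v ℚ.+ acc) 0ℚ xs

  minL-≤ : ∀ R g {x} xs → lookup R x ≡ true → x ∈ˡ xs → minL R g xs ≤∞ g x
  minL-≤ R g (x ∷ xs) Rx (here refl) rewrite Rx = min∞-≤ˡ (g x) (minL R g xs)
  minL-≤ R g (v ∷ xs) Rx (there x∈xs) with lookup R v
  ... | true  = ≤∞-trans (min∞-≤ʳ (g v) (minL R g xs)) (minL-≤ R g xs Rx x∈xs)
  ... | false = minL-≤ R g xs Rx x∈xs

  Attained : Subset n → (Fin n → ℚ∞) → ℚ∞ → Set
  Attained R g m = m ≡ ∞ ⊎ Σ (Fin n) (λ x → lookup R x ≡ true × m ≡ g x)

  minL-attained : ∀ R g xs → Attained R g (minL R g xs)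
  minL-attained R g []       = inj₁ refl
  minL-attained R g (v ∷ xs) with lookup R v in Rv
  ... | false = minL-attained R g xs
  ... | true with min∞-sel (g v) (minL R g xs)
  ...   | inj₁ min≡gv = inj₂ (v , Rv , min≡gv)
  ...   | inj₂ min≡rest = subst (Attained R g) (sym min≡rest) (minL-attained R g xs)

  maxL-≥ : ∀ R g {x} xs → lookup R x ≡ true → x ∈ˡ xs → g x ≤∞ maxL R g xs
  maxL-≥ R g (x ∷ xs) Rx (here refl) rewrite Rx = max∞-≥ˡ (g x) (maxL R g xs)
  maxL-≥ R g (v ∷ xs) Rx (there x∈xs) with lookup R v
  ... | true  = ≤∞-trans (maxL-≥ R g xs Rx x∈xs) (max∞-≥ʳ (g v) (maxL R g xs))
  ... | false = maxL-≥ R g xs Rx x∈xs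

  -- The maximum over the empty set is 0, so every maximum is non-negative.
  maxL-nonNeg : ∀ R g xs → NonNeg∞ (maxL R g xs)
  maxL-nonNeg R g []       = ≤∞-refl
  maxL-nonNeg R g (v ∷ xs) with lookup R v
  ... | true  = ≤∞-trans (maxL-nonNeg R g xs) (max∞-≥ʳ (g v) (maxL R g xs))
  ... | false = maxL-nonNeg R g xs

  maxL-lub : ∀ R g {z} xs → (∀ x → g x ≤∞ z) → NonNeg∞ z → maxL R g xs ≤∞ z
  maxL-lub R g []       g≤z 0≤z = 0≤z
  maxL-lub R g (v ∷ xs) g≤z 0≤z with lookup R v
  ... | true  = max∞-lub (g≤z v) (maxL-lub R g xs g≤z 0≤z)
  ... | false = maxL-lub R g xs g≤z 0≤z

  sumL∞-mono : ∀ {g h} xs → (∀ v → g v ≤∞ h v) → sumL∞ g xs ≤∞ sumL∞ h xs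
  sumL∞-mono []       g≤h = ≤∞-refl
  sumL∞-mono (v ∷ xs) g≤h = +∞-mono (g≤h v) (sumL∞-mono xs g≤h)

  sumL∞-+ : ∀ g h xs → sumL∞ (λ v → g v +∞ h v) xs ≡ (sumL∞ g xs +∞ sumL∞ h xs)
  sumL∞-+ g h []       = cong fin (sym (+-identityʳ 0ℚ))
  sumL∞-+ g h (v ∷ xs) =
    trans (cong ((g v +∞ h v) +∞_) (sumL∞-+ g h xs))
          (+∞-interchange (g v) (h v) (sumL∞ g xs) (sumL∞ h xs))

  sumL∞-nonNeg : ∀ {g} xs → (∀ v → NonNeg∞ (g v)) → NonNeg∞ (sumL∞ g xs)
  sumL∞-nonNeg []       0≤g = ≤∞-refl
  sumL∞-nonNeg (v ∷ xs) 0≤g = +∞-nonNeg (0≤g v) (sumL∞-nonNeg xs 0≤g)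

  sumL-nonNeg : ∀ {g} xs → (∀ v → 0ℚ ≤ g v) → 0ℚ ≤ sumL g xs
  sumL-nonNeg []       0≤g = ≤-refl
  sumL-nonNeg (v ∷ xs) 0≤g = +-nonNeg (0≤g v) (sumL-nonNeg xs 0≤g)

  sumL∞-scale : ∀ c D xs → (∀ v → 0ℚ ≤ c v) → sumL∞ (λ v → c v ·∞ D) xs ≤∞ (sumL c xs ·∞ D)
  sumL∞-scale c D []       0≤c = ≤∞-reflexive (sym (zero-·∞ D refl))
  sumL∞-scale c D (v ∷ xs) 0≤c =
    ≤∞-trans (+∞-mono (≤∞-refl {c v ·∞ D}) (sumL∞-scale c D xs 0≤c))
             (·∞-superdistrib D (0≤c v) (sumL-nonNeg xs 0≤c))

  sumL-select : ∀ b g xs → sumL (λ v → select b (g v)) xs ≡ select b (sumL g xs)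
  sumL-select true  g xs       = refl
  sumL-select false g []       = refl
  sumL-select false g (v ∷ xs) = trans (cong (0ℚ ℚ.+_) (sumL-select false g xs)) (+-identityʳ 0ℚ)

  sumL-≤-+ : ∀ g h₁ h₂ xs → (∀ v → g v ≤ h₁ v ℚ.+ h₂ v) → sumL g xs ≤ sumL h₁ xs ℚ.+ sumL h₂ xs
  sumL-≤-+ g h₁ h₂ []       g≤h = ≤-reflexive (sym (+-identityʳ 0ℚ))
  sumL-≤-+ g h₁ h₂ (v ∷ xs) g≤h =
    ≤-trans (+-mono-≤ (g≤h v) (sumL-≤-+ g h₁ h₂ xs g≤h))
            (≤-reflexive (interchange (h₁ v) (h₂ v) (sumL h₁ xs) (sumL h₂ xs)))

open Folds

module ShortestPaths {n : ℕ} (G : Graph n) (d : Fin n → Fin n → ℚ∞)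
                     (isSP : IsShortestPathDist G d) where
  open Graph G

  _++ʷ_ : ∀ {u v w} → Walk G u v → Walk G v w → Walk G u w
  Walk.[]      ++ʷ q = q
  (e Walk.∷ p) ++ʷ q = e Walk.∷ (p ++ʷ q)

  length-++ : ∀ {u v w} (p : Walk G u v) (q : Walk G v w) →
              walkLength G (p ++ʷ q) ≡ walkLength G p ℚ.+ walkLength G q
  length-++ Walk.[] q = sym (+-identityˡ _)
  length-++ (_∷_ {u} {w} e p) q =
    trans (cong (l u w ℚ.+_) (length-++ p q)) (sym (+-assoc (l u w) _ _))

  length-nonNeg : ∀ {u v} (p : Walk G u v) → 0ℚ ≤ walkLength G p
  length-nonNeg Walk.[]      = ≤-refl
  length-nonNeg (e Walk.∷ p) = +-nonNeg (<⇒≤ (l-pos e)) (length-nonNeg p)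

  d-nonNeg : ∀ u v → NonNeg∞ (d u v)
  d-nonNeg u v with isSP u v
  ... | inj₁ (duv≡∞ , _) rewrite duv≡∞ = _ ≤∞∞
  ... | inj₂ (x , duv≡x , (p , len-p≡x) , _) rewrite duv≡x =
    fin≤fin (subst (0ℚ ≤_) len-p≡x (length-nonNeg p))

  -- Triangle inequality: a u–v walk followed by a v–w walk is a u–w walk.
  d-triangle : ∀ u v w → d u w ≤∞ (d u v +∞ d v w)
  d-triangle u v w with isSP u v | isSP v w
  ... | inj₁ (duv≡∞ , _) | _ = ∞-absorbˡ duv≡∞
  ... | inj₂ (x , duv≡x , _) | inj₁ (dvw≡∞ , _) rewrite duv≡x = ∞-absorbʳ (fin x) dvw≡∞
  ... | inj₂ (x , duv≡x , (p , len-p≡x) , _) | inj₂ (y , dvw≡y , (q , len-q≡y) , _)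
    with isSP u w
  ...   | inj₁ (_ , no-walk) = ⊥-elim (no-walk (p ++ʷ q))
  ...   | inj₂ (z , duw≡z , _ , shortest) rewrite duv≡x | dvw≡y | duw≡z =
    fin≤fin (≤-trans (shortest (p ++ʷ q))
                     (≤-reflexive (trans (length-++ p q) (cong₂ ℚ._+_ len-p≡x len-q≡y))))

  dist-≤ : ∀ v T {x} → lookup T x ≡ true → minSet T (d v) ≤∞ d v x
  dist-≤ v T {x} Tx = minL-≤ T (d v) (allFin n) Tx (∈-allFin x)

  dist-nonNeg : ∀ v T → NonNeg∞ (minSet T (d v))
  dist-nonNeg v T with minL-attained T (d v) (allFin n)
  ... | inj₁ dist≡∞          = subst NonNeg∞ (sym dist≡∞) (_ ≤∞∞)
  ... | inj₂ (x , _ , dist≡) = subst NonNeg∞ (sym dist≡) (d-nonNeg v x)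

  dist-triangle : ∀ v r T → minSet T (d v) ≤∞ (d v r +∞ minSet T (d r))
  dist-triangle v r T with minL-attained T (d r) (allFin n)
  ... | inj₁ dist≡∞ = ∞-absorbʳ (d v r) dist≡∞
  ... | inj₂ (x , Tx , dist≡) =
    subst (λ z → minSet T (d v) ≤∞ (d v r +∞ z)) (sym dist≡) (≤∞-trans (dist-≤ v T Tx) (d-triangle v r x))

facility-split : ∀ {n} (f : Fin n → ℚ) (R₁ R₂ : Subset n) →
  sumSet (R₁ ∪ R₂) f ≤ sumSet R₁ f ℚ.+ sumSet R₂ (λ v → if lookup R₁ v then 0ℚ else f v)
facility-split {n} f R₁ R₂ =
  sumL-≤-+ (λ v → select (lookup (R₁ ∪ R₂) v) (f v)) (λ v → select (lookup R₁ v) (f v))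
           (λ v → select (lookup R₂ v) (if lookup R₁ v then 0ℚ else f v)) (allFin n) pointwise
  where
  pointwise : ∀ v → select (lookup (R₁ ∪ R₂) v) (f v)
                    ≤ select (lookup R₁ v) (f v)
                      ℚ.+ select (lookup R₂ v) (if lookup R₁ v then 0ℚ else f v)
  pointwise v rewrite lookup-zipWith _∨_ v R₁ R₂ with lookup R₁ v | lookup R₂ v
  ... | true  | true  = ≤-reflexive (sym (+-identityʳ (f v)))
  ... | true  | false = ≤-reflexive (sym (+-identityʳ (f v)))
  ... | false | true  = ≤-reflexive (sym (+-identityˡ (f v)))
  ... | false | false = ≤-reflexive (sym (+-identityʳ 0ℚ))

combine-costs : ∀ {F F₁ F₂ X S M} → F ≤ F₁ ℚ.+ F₂ → X ≤∞ (S +∞ M) →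
                (fin F +∞ X) ≤∞ ((fin F₁ +∞ S) +∞ (fin F₂ +∞ M))
combine-costs {F₁ = F₁} {F₂} {S = S} {M} F≤F₁+F₂ X≤S+M =
  ≤∞-trans (+∞-mono (fin≤fin F≤F₁+F₂) X≤S+M)
           (≤∞-reflexive (+∞-interchange (fin F₁) (fin F₂) S M))

module SingleFailure {n : ℕ} (G : Graph n) (d : Fin n → Fin n → ℚ∞) (isSP : IsShortestPathDist G d)
  (f ω : Fin n → ℚ) (ω-nonNeg : ∀ v → 0ℚ ≤ ω v)
  (R₁ R₂ : Subset n) (a : Fin n → Fin n) (assigned : Costs.IsAssignment d f ω R₁ a) where

  open Costs d f ω
  open ShortestPaths G d isSP
  open ≤∞-Reasoning

  R : Subset n
  R = R₁ ∪ R₂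

  ω' : Fin n → ℚ
  ω' = Derived.ω' f ω R₁ a

  backup : Fin n → ℚ∞
  backup r = dist r (R - r)

  rerouted : Fin n → Fin n → ℚ
  rerouted r v = select (lookup R₁ r) (select (does (a v ≟ r)) (ω v))

  rerouted-nonNeg : ∀ r v → 0ℚ ≤ rerouted r v
  rerouted-nonNeg r v = select-nonNeg (lookup R₁ r) (select-nonNeg (does (a v ≟ r)) (ω-nonNeg v))

  rerouted-total : ∀ r → sumL (rerouted r) (allFin n) ≡ ω' r
  rerouted-total r = sumL-select (lookup R₁ r) (λ v → select (does (a v ≟ r)) (ω v)) (allFin n)

  rerouted-self : ∀ {v} → a v ∈ˢ R₁ → rerouted (a v) v ≡ ω v
  rerouted-self {v} av∈R₁
    rewrite []=⇒lookup av∈R₁ | dec-true (a v ≟ a v) refl = refl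

  unaffected-client : ∀ {r v} → a v ∈ˢ R₁ → d v (a v) ≡ dist v R₁ → a v ≢ r →
    (ω v ·∞ dist v (R - r)) ≤∞ (ω v ·∞ dist v R₁ +∞ rerouted r v ·∞ backup r)
  unaffected-client {r} {v} av∈R₁ d-av av≢r = begin
    ω v ·∞ dist v (R - r)  ≲⟨ ·∞-monoʳ (ω-nonNeg v) (dist-≤ v (R - r) av∈R-r) ⟩
    ω v ·∞ d v (a v)       ≡⟨ cong (ω v ·∞_) d-av ⟩
    ω v ·∞ dist v R₁       ≲⟨ ≤∞-+nonNeg _ (·∞-nonNeg (rerouted-nonNeg r v) (dist-nonNeg r (R - r))) ⟩
    ω v ·∞ dist v R₁ +∞ rerouted r v ·∞ backup r ∎
    where
    av∈R-r : lookup (R - r) (a v) ≡ true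
    av∈R-r = []=⇒lookup (x∈p∧x≢y⇒x∈p-y (x∈p∪q⁺ (inj₁ av∈R₁)) av≢r)

  detoured-client : ∀ {r v} → a v ∈ˢ R₁ → d v (a v) ≡ dist v R₁ → a v ≡ r →
    (ω v ·∞ dist v (R - r)) ≤∞ (ω v ·∞ dist v R₁ +∞ rerouted r v ·∞ backup r)
  detoured-client {r} {v} av∈R₁ d-av refl = begin
    ω v ·∞ dist v (R - r)             ≲⟨ ·∞-monoʳ (ω-nonNeg v) (dist-triangle v r (R - r)) ⟩
    ω v ·∞ (d v r +∞ backup r)        ≲⟨ ·∞-subdistrib (ω v) (d v r) (backup r) ⟩
    ω v ·∞ d v r +∞ ω v ·∞ backup r   ≡⟨ cong₂ _+∞_ (cong (ω v ·∞_) d-av)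
                                                     (cong (_·∞ backup r) (sym (rerouted-self av∈R₁))) ⟩
    ω v ·∞ dist v R₁ +∞ rerouted r v ·∞ backup r ∎

  served-client : ∀ {r v} → a v ∈ˢ R₁ → d v (a v) ≡ dist v R₁ → Dec (a v ≡ r) →
    (ω v ·∞ dist v (R - r)) ≤∞ (ω v ·∞ dist v R₁ +∞ rerouted r v ·∞ backup r)
  served-client av∈R₁ d-av (no  av≢r) = unaffected-client av∈R₁ d-av av≢r
  served-client av∈R₁ d-av (yes av≡r) = detoured-client av∈R₁ d-av av≡r

  -- Clients without
  -- demand cost nothing; if no facility of R₁ is reachable the right-hand side
  -- is ∞; otherwise the assignment gives v a nearest facility a v ∈ R₁.
  client-bound : ∀ r v → (ω v ·∞ dist v (R - r)) ≤∞ (ω v ·∞ dist v R₁ +∞ rerouted r v ·∞ backup r)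
  client-bound r v with ω v ℚ.≟ 0ℚ
  ... | yes ωv≡0 =
    ≤∞-trans (≤∞-reflexive (zero-·∞ (dist v (R - r)) ωv≡0))
             (+∞-nonNeg (·∞-nonNeg (ω-nonNeg v) (dist-nonNeg v R₁))
                        (·∞-nonNeg (rerouted-nonNeg r v) (dist-nonNeg r (R - r))))
  ... | no ωv≢0 with minL-attained R₁ (d v) (allFin n)
  ...   | inj₁ unserved = ∞-absorbˡ (trans (cong (ω v ·∞_) unserved) (nonZero-·∞∞ ωv≢0))
  ...   | inj₂ (x , R₁x , _) with assigned v (x , lookup⇒[]= x R₁ R₁x)
  ...     | av∈R₁ , d-av = served-client av∈R₁ d-av (a v ≟ r)

  ω'-outside : ∀ {r} → lookup R₁ r ≡ false → ω' r ≡ 0ℚ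
  ω'-outside {r} r∉R₁ = cong (λ b → select b (sumV (λ u → select (does (a u ≟ r)) (ω u)))) r∉R₁

  bottleneck : ℚ∞
  bottleneck = maxSet R₁ (λ r → ω' r ·∞ backup r)

  bottleneck-bound : ∀ r → (ω' r ·∞ backup r) ≤∞ bottleneck
  bottleneck-bound r = by-membership (lookup R₁ r) refl
    where
    by-membership : ∀ b → lookup R₁ r ≡ b → (ω' r ·∞ backup r) ≤∞ bottleneck
    by-membership true  r∈R₁ = maxL-≥ R₁ (λ r → ω' r ·∞ backup r) (allFin n) r∈R₁ (∈-allFin r)
    by-membership false r∉R₁ =
      ≤∞-trans (≤∞-reflexive (zero-·∞ (backup r) (ω'-outside r∉R₁)))
               (maxL-nonNeg R₁ (λ r → ω' r ·∞ backup r) (allFin n))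

  failure-bound : ∀ r → sumV∞ (λ v → ω v ·∞ dist v (R - r)) ≤∞ (Cship R₁ +∞ ω' r ·∞ backup r)
  failure-bound r = begin
    sumV∞ (λ v → ω v ·∞ dist v (R - r))
      ≲⟨ sumL∞-mono (allFin n) (client-bound r) ⟩
    sumV∞ (λ v → ω v ·∞ dist v R₁ +∞ rerouted r v ·∞ backup r)
      ≡⟨ sumL∞-+ (λ v → ω v ·∞ dist v R₁) (λ v → rerouted r v ·∞ backup r) (allFin n) ⟩
    Cship R₁ +∞ sumV∞ (λ v → rerouted r v ·∞ backup r)
      ≲⟨ +∞-mono (≤∞-refl {Cship R₁})
                 (sumL∞-scale (rerouted r) (backup r) (allFin n) (rerouted-nonNeg r)) ⟩
    Cship R₁ +∞ sumL (rerouted r) (allFin n) ·∞ backup r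
      ≡⟨ cong (λ w → Cship R₁ +∞ w ·∞ backup r) (rerouted-total r) ⟩
    Cship R₁ +∞ ω' r ·∞ backup r ∎

  Cship-nonNeg : NonNeg∞ (Cship R₁)
  Cship-nonNeg = sumL∞-nonNeg (allFin n) (λ u → ·∞-nonNeg (ω-nonNeg u) (dist-nonNeg u R₁))

  worst-failure-bound :
    maxSet R (λ r → sumV∞ (λ v → ω v ·∞ dist v (R - r))) ≤∞ (Cship R₁ +∞ bottleneck)
  worst-failure-bound =
    maxL-lub R (λ r → sumV∞ (λ v → ω v ·∞ dist v (R - r))) (allFin n)
      (λ r → ≤∞-trans (failure-bound r) (+∞-mono (≤∞-refl {Cship R₁}) (bottleneck-bound r)))
      (+∞-nonNeg Cship-nonNeg (maxL-nonNeg R₁ (λ r → ω' r ·∞ backup r) (allFin n)))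

-- Lemma 2.6: the facility part is bounded by facility-split (f' vanishes on
-- R₁), the worst-failure part by SingleFailure.

lemma2p6 : ∀ {n : ℕ} (G : Graph n) (d : Fin n → Fin n → ℚ∞) → IsShortestPathDist G d →
    (f ω : Fin n → ℚ) → (∀ v → 0ℚ ≤ f v) → (∀ v → 0ℚ ≤ ω v) →
    (R₁ R₂ : Subset n) (a : Fin n → Fin n) → Costs.IsAssignment d f ω R₁ a →
    Costs.CRFTFL d f ω (R₁ ∪ R₂)
    ≤∞ (Costs.CUFL d f ω R₁
    +∞ Cconcbu d (Derived.f' f ω R₁ a) (Derived.ω' f ω R₁ a) R₁ R₂)
lemma2p6 G d isSP f ω _ ω-nonNeg R₁ R₂ a assigned =
  combine-costs (facility-split f R₁ R₂)
                (SingleFailure.worst-failure-bound G d isSP f ω ω-nonNeg R₁ R₂ a assigned)
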